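{- Let $n\ge1$, $C\in\mathbb{N}$ and let $a_1,\ldots,a_{3n}$ be nonnegative integers with $\frac{C}{4}<a_i<\frac{C}{2}$ for all $i$ and $\sum_{i=1}^{3n}a_i=nC$. Let $\lambda>3n$ be an integer and $$P_\lambda(q)=n q^{\lambda C+1}+\sum_{i=1}^{3n} q^{\lambda C+1+\lambda a_i}+\sum_{i=1}^{3n}(\lambda a_i-1)q^{\lambda C+\lambda a_i+2}.$$ Let $T$ be a rooted tree with $Av_T(q)=P_\lambda(q)$, and let $I$ be the set of vertices of $T$ whose label is of the form $\lambda C+1+\lambda a_i$ for some $i$. Then every vertex of $I$ is a child of a vertex labeled $\lambda C+1$.
   Context: Let $T$ be a finite tree rooted at a vertex $r$. For a vertex $v$, the maximal subtree rooted at $v$ consists of $v$ and all its descendants; its size is its number of vertices. The vertices of $T$ are labeled as follows: the root is labeled $0$, and a child $v$ of a vertex labeled $\mu$ is labeled $\mu + |\text{maximal subtree rooted at } v|$. The avalanche polynomial of $T$ is $Av_T(q)=\sum_{i\ge 1} p_i q^i$, where $p_i$ is the number of vertices of $T$ labeled $i$. -}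

module Defs where

open import Data.Nat using (ℕ; zero; suc; _+_; _*_; _∸_)
open import Data.Nat.Properties using (_≟_)
open import Data.List using (List; []; _∷_; _++_; map; filter; length; tabulate)
open import Data.Nat.ListAction using (sum)
open import Data.Fin using (Fin)
open import Data.Maybe using (Maybe; just; nothing; maybe)
open import Relation.Nullary.Decidable using (⌊_⌋)
open import Data.Bool using (if_then_else_)

data Tree : Set where
  node : List Tree → Tree

mutual
  data Vertex : Tree → Set where
    root : ∀ {t} → Vertex t
    sub  : ∀ {ts} → VertexF ts → Vertex (node ts)

  data VertexF : List Tree → Set where
    here  : ∀ {t ts} → Vertex t → VertexF (t ∷ ts)
    there : ∀ {t ts} → VertexF ts → VertexF (t ∷ ts)

mutual
  size : Tree → ℕ
  size (node ts) = suc (sizes ts)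

  sizes : List Tree → ℕ
  sizes [] = 0
  sizes (t ∷ ts) = size t + sizes ts

-- labelFrom μ t v : label of v when the root of t carries label μ.
-- A child c of a vertex labelled μ gets label μ + size(maximal subtree at c).
mutual
  labelFrom : ℕ → (t : Tree) → Vertex t → ℕ
  labelFrom μ t root = μ
  labelFrom μ (node ts) (sub p) = labelF μ ts p

  labelF : ℕ → (ts : List Tree) → VertexF ts → ℕ
  labelF μ (t ∷ ts) (here v) = labelFrom (μ + size t) t v
  labelF μ (t ∷ ts) (there p) = labelF μ ts p

label : (t : Tree) → Vertex t → ℕ
label t = labelFrom 0 t

mutual
  allVertices : (t : Tree) → List (Vertex t)
  allVertices (node ts) = root ∷ map sub (allF ts)

  allF : (ts : List Tree) → List (VertexF ts)
  allF [] = []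
  allF (t ∷ ts) = map here (allVertices t) ++ map there (allF ts)

mutual
  parent : ∀ {t} → Vertex t → Maybe (Vertex t)
  parent root = nothing
  parent (sub p) = just (maybe sub root (parentF p))

  -- nothing means: the parent is the root of the enclosing node
  parentF : ∀ {ts} → VertexF ts → Maybe (VertexF ts)
  parentF (here v) = Data.Maybe.map here (parent v)
  parentF (there p) = Data.Maybe.map there (parentF p)

-- p_k : number of vertices of t labelled k; Av_T(q) = Σ_{k≥1} p_k q^k
avCoeff : Tree → ℕ → ℕ
avCoeff t k = length (filter (λ v → label t v ≟ k) (allVertices t))

ind : ℕ → ℕ → ℕ → ℕ
ind k m c = if ⌊ k ≟ m ⌋ then c else 0

-- coefficient of q^k in
-- P_λ(q) = n q^{λC+1} + Σ_i q^{λC+1+λ a_i} + Σ_i (λ a_i − 1) q^{λC+λ a_i+2}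
Pcoeff : (n C : ℕ) → (Fin (3 * n) → ℕ) → (lam : ℕ) → ℕ → ℕ
Pcoeff n C a lam k =
  ind k (lam * C + 1) n
  + sum (tabulate (λ i → ind k (lam * C + 1 + lam * a i) 1))
  + sum (tabulate (λ i → ind k (lam * C + lam * a i + 2) (lam * a i ∸ 1)))

module Submission where

-- Write Λ = λC+1, A_i = Λ + λa_i and B_i = λC + λa_i + 2 for the exponents
-- of P_λ.  For every weight g : ℕ → ℕ with g 0 = 0, the sum of g over all vertex labels of T
-- only depends on the multiplicities of the positive labels, so it equals
--   n·g(Λ) + Σ_i g(A_i) + Σ_i (λa_i − 1)·g(B_i)                         (moment identity).
-- Suitable weights show: every non-root label lies in {Λ} ∪ A ∪ B, exactly n labels are Λ,
-- T has 1 + n + λnC vertices, and the A-labels carry total "height" Σ (ℓ − Λ) = λnC.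
-- A label of a child of the root is the size of its subtree, hence ≥ Λ; since n of them are
-- exactly Λ and these subtrees have total size nΛ, every child of the root has size Λ and
-- label Λ.  Each grandchild u has label Λ + |u| and all labels below it lie in A ∪ B; such a
-- subtree carries height-mass ≥ |u|, with equality only if no vertex strictly below u is
-- A-labelled (if u itself is B-labelled, some deeper A-vertex already has height > |u|).
-- The grandchild subtrees have total size λnC, equal to the total height-mass, so equality
-- holds everywhere: the A-labelled vertices are exactly grandchildren of the root, and their
-- parents are children of the root, labelled Λ.

open import Defs
open import Data.Nat using (ℕ; zero; suc; _+_; _*_; _∸_; _≤_; _<_; z≤n; s≤s)
open import Data.Nat.Properties
open import Data.Nat.Divisibility using (_∣_; m∣m*n; ∣m+n∣m⇒∣n; >⇒∤)
open import Data.Nat.ListAction using (sum)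
open import Data.Nat.ListAction.Properties using (sum-++)
open import Data.Nat.Tactic.RingSolver using (solve-∀)
open import Data.Fin using (Fin)
open import Data.Fin.Properties using (any?)
open import Data.List using (List; []; _∷_; _++_; map; filter; length; tabulate; replicate; concat)
open import Data.List.Properties using (map-++; map-∘; map-tabulate; tabulate-cong; length-map)
open import Data.List.Relation.Unary.All using (All; []; _∷_)
import Data.List.Relation.Unary.All as All
open import Data.List.Relation.Unary.All.Properties using (map⁺; map⁻)
open import Data.Maybe using (just; nothing; maybe)
import Data.Maybe as Maybe
open import Data.Product using (Σ; ∃; _×_; _,_; proj₂)
open import Data.Sum using (_⊎_; inj₁; inj₂)
open import Data.Unit using (⊤; tt)
open import Data.Empty using (⊥-elim)
open import Data.Bool using (if_then_else_)
open import Relation.Nullary using (Dec; yes; no; ¬_)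
open import Relation.Nullary.Decidable using (⌊_⌋; ¬?; _⊎-dec_; decidable-stable)
open import Relation.Binary.PropositionalEquality
open ≡-Reasoning

χ : {P : Set} → Dec P → ℕ
χ (yes _) = 1
χ (no _)  = 0

χ-yes : {P : Set} (d : Dec P) → P → χ d ≡ 1
χ-yes (yes _) _  = refl
χ-yes (no ¬p) p = ⊥-elim (¬p p)

χ-no : {P : Set} (d : Dec P) → ¬ P → χ d ≡ 0
χ-no (yes p) ¬p = ⊥-elim (¬p p)
χ-no (no _) _   = refl

χ-zero : {P : Set} (d : Dec P) → χ d ≡ 0 → ¬ P
χ-zero (no ¬p) _ = ¬p

count : ℕ → List ℕ → ℕ
count k xs = sum (map (λ x → χ (x ≟ k)) xs)

length-filter-χ : {X : Set} {P : X → Set} (P? : ∀ x → Dec (P x)) (xs : List X)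
  → length (filter P? xs) ≡ sum (map (λ x → χ (P? x)) xs)
length-filter-χ P? [] = refl
length-filter-χ P? (x ∷ xs) with P? x
... | yes _ = cong suc (length-filter-χ P? xs)
... | no _  = length-filter-χ P? xs

sum-map-++ : {X : Set} (f : X → ℕ) (xs ys : List X)
  → sum (map f (xs ++ ys)) ≡ sum (map f xs) + sum (map f ys)
sum-map-++ f xs ys = trans (cong sum (map-++ f xs ys)) (sum-++ (map f xs) (map f ys))

sum-map-cong : {X : Set} (f g : X → ℕ) (xs : List X)
  → All (λ x → f x ≡ g x) xs → sum (map f xs) ≡ sum (map g xs)
sum-map-cong f g [] [] = refl
sum-map-cong f g (x ∷ xs) (e ∷ es) = cong₂ _+_ e (sum-map-cong f g xs es)

sum-map-mono : {X : Set} (f g : X → ℕ) (xs : List X)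
  → All (λ x → f x ≤ g x) xs → sum (map f xs) ≤ sum (map g xs)
sum-map-mono f g [] [] = z≤n
sum-map-mono f g (x ∷ xs) (le ∷ les) = +-mono-≤ le (sum-map-mono f g xs les)

+-tight : ∀ {a b c d} → a ≤ b → c ≤ d → a + c ≡ b + d → a ≡ b
+-tight {a} {b} {c} {d} a≤b c≤d e =
  ≤-antisym a≤b (+-cancelʳ-≤ c b a (≤-trans (+-monoʳ-≤ b c≤d) (≤-reflexive (sym e))))

sum-map-tight : {X : Set} (f g : X → ℕ) (xs : List X)
  → All (λ x → f x ≤ g x) xs → sum (map f xs) ≡ sum (map g xs) → All (λ x → f x ≡ g x) xs
sum-map-tight f g [] [] _ = []
sum-map-tight f g (x ∷ xs) (le ∷ les) e = fx≡gx ∷ sum-map-tight f g xs les rest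
  where
  fx≡gx : f x ≡ g x
  fx≡gx = +-tight le (sum-map-mono f g xs les) e
  rest : sum (map f xs) ≡ sum (map g xs)
  rest = +-cancelˡ-≡ (f x) _ _ (trans e (cong (_+ sum (map g xs)) (sym fx≡gx)))

entries≤sum : ∀ xs → All (_≤ sum xs) xs
entries≤sum [] = []
entries≤sum (x ∷ xs) = m≤m+n x (sum xs) ∷ All.map (λ le → ≤-trans le (m≤n+m (sum xs) x)) (entries≤sum xs)

m*χ≤ : ∀ m y → m ≤ y → m * χ (y ≟ m) ≤ y
m*χ≤ m y m≤y with y ≟ m
... | yes _ = subst (_≤ y) (sym (*-identityʳ m)) m≤y
... | no _  = subst (_≤ y) (sym (*-zeroʳ m)) z≤n

m*χ≡⇒≡ : ∀ m y → m ≤ y → m * χ (y ≟ m) ≡ y → y ≡ m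
m*χ≡⇒≡ m y m≤y e with y ≟ m
... | yes y≡m = y≡m
... | no _    = trans (sym e') (sym (n≤0⇒n≡0 (subst (m ≤_) (sym e') m≤y)))
  where
  e' : 0 ≡ y
  e' = trans (sym (*-zeroʳ m)) e

m*count≤sum : ∀ m xs → All (m ≤_) xs → m * count m xs ≤ sum xs
m*count≤sum m [] [] = ≤-reflexive (*-zeroʳ m)
m*count≤sum m (x ∷ xs) (m≤x ∷ m≤xs) =
  ≤-trans (≤-reflexive (*-distribˡ-+ m (χ (x ≟ m)) (count m xs))) (+-mono-≤ (m*χ≤ m x m≤x) (m*count≤sum m xs m≤xs))

all-equal-by-sum : ∀ m xs → All (m ≤_) xs → sum xs ≡ m * count m xs → All (_≡ m) xs
all-equal-by-sum m [] [] _ = []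
all-equal-by-sum m (x ∷ xs) (m≤x ∷ m≤xs) e =
  m*χ≡⇒≡ m x m≤x head ∷ all-equal-by-sum m xs m≤xs (sym tail)
  where
  e' : m * χ (x ≟ m) + m * count m xs ≡ x + sum xs
  e' = trans (sym (*-distribˡ-+ m (χ (x ≟ m)) (count m xs))) (sym e)
  head : m * χ (x ≟ m) ≡ x
  head = +-tight (m*χ≤ m x m≤x) (m*count≤sum m xs m≤xs) e'
  tail : m * count m xs ≡ sum xs
  tail = +-cancelˡ-≡ x _ _ (trans (cong (_+ m * count m xs) (sym head)) e')

count-all-equal : ∀ k xs → All (_≡ k) xs → count k xs ≡ length xs
count-all-equal k [] [] = refl
count-all-equal k (x ∷ xs) (x≡k ∷ es) = cong₂ _+_ (χ-yes (x ≟ k) x≡k) (count-all-equal k xs es)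

Σ< : ℕ → (ℕ → ℕ) → ℕ
Σ< zero f    = 0
Σ< (suc M) f = Σ< M f + f M

Σ<-cong : ∀ M (f g : ℕ → ℕ) → (∀ k → k < M → f k ≡ g k) → Σ< M f ≡ Σ< M g
Σ<-cong zero f g e    = refl
Σ<-cong (suc M) f g e = cong₂ _+_ (Σ<-cong M f g (λ k k<M → e k (m<n⇒m<1+n k<M))) (e M ≤-refl)

Σ<-zero : ∀ M (f : ℕ → ℕ) → (∀ k → k < M → f k ≡ 0) → Σ< M f ≡ 0
Σ<-zero zero f e    = refl
Σ<-zero (suc M) f e = cong₂ _+_ (Σ<-zero M f (λ k k<M → e k (m<n⇒m<1+n k<M))) (e M ≤-refl)

Σ<-+ : ∀ M (f g : ℕ → ℕ) → Σ< M (λ k → f k + g k) ≡ Σ< M f + Σ< M g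
Σ<-+ zero f g    = refl
Σ<-+ (suc M) f g = trans (cong (_+ (f M + g M)) (Σ<-+ M f g)) (interchange (Σ< M f) (Σ< M g) (f M) (g M))
  where
  interchange : ∀ a b c d → (a + b) + (c + d) ≡ (a + c) + (b + d)
  interchange = solve-∀

Σ<-pick : ∀ M (g : ℕ → ℕ) x → x < M → Σ< M (λ k → g k * χ (x ≟ k)) ≡ g x
Σ<-pick (suc M) g x x<1+M with x ≟ M
... | yes refl = cong₂ _+_ (Σ<-zero x _ (λ k k<x → trans (cong (g k *_) (χ-no (x ≟ k) (λ x≡k → <-irrefl (sym x≡k) k<x)))
                                                        (*-zeroʳ (g k))))
                           (*-identityʳ (g x))
... | no x≢M   = trans (cong₂ _+_ (Σ<-pick M g x (≤∧≢⇒< (≤-pred x<1+M) x≢M)) (*-zeroʳ (g M))) (+-identityʳ (g x))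

sum-by-multiplicity : ∀ M (g : ℕ → ℕ) xs → All (_< M) xs → sum (map g xs) ≡ Σ< M (λ k → g k * count k xs)
sum-by-multiplicity M g [] [] = sym (Σ<-zero M _ (λ k _ → *-zeroʳ (g k)))
sum-by-multiplicity M g (x ∷ xs) (x<M ∷ xs<M) = sym (begin
  Σ< M (λ k → g k * (χ (x ≟ k) + count k xs))
    ≡⟨ Σ<-cong M _ _ (λ k _ → *-distribˡ-+ (g k) (χ (x ≟ k)) (count k xs)) ⟩
  Σ< M (λ k → g k * χ (x ≟ k) + g k * count k xs)
    ≡⟨ Σ<-+ M _ _ ⟩
  Σ< M (λ k → g k * χ (x ≟ k)) + Σ< M (λ k → g k * count k xs)
    ≡⟨ cong₂ _+_ (Σ<-pick M g x x<M) (sym (sum-by-multiplicity M g xs xs<M)) ⟩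
  g x + sum (map g xs) ∎)

same-counts⇒same-sums : ∀ (g : ℕ → ℕ) → g 0 ≡ 0 → ∀ xs ys
  → (∀ k → 1 ≤ k → count k xs ≡ count k ys) → sum (map g xs) ≡ sum (map g ys)
same-counts⇒same-sums g g0 xs ys same = begin
  sum (map g xs)                ≡⟨ sum-by-multiplicity M g xs (bounded xs (m≤m+n _ _)) ⟩
  Σ< M (λ k → g k * count k xs) ≡⟨ Σ<-cong M _ _ (λ k _ → same-term k) ⟩
  Σ< M (λ k → g k * count k ys) ≡⟨ sym (sum-by-multiplicity M g ys (bounded ys (m≤n+m _ _))) ⟩
  sum (map g ys)                ∎
  where
  M : ℕ
  M = suc (sum xs + sum ys)
  bounded : ∀ zs → sum zs ≤ sum xs + sum ys → All (_< M) zs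
  bounded zs le = All.map (λ z≤ → s≤s (≤-trans z≤ le)) (entries≤sum zs)
  same-term : ∀ k → g k * count k xs ≡ g k * count k ys
  same-term zero    = trans (cong (_* count 0 xs) g0) (cong (_* count 0 ys) (sym g0))
  same-term (suc k) = cong (g (suc k) *_) (same (suc k) (s≤s z≤n))

Σtab-cong : ∀ {m} (f g : Fin m → ℕ) → (∀ i → f i ≡ g i) → sum (tabulate f) ≡ sum (tabulate g)
Σtab-cong f g e = cong sum (tabulate-cong e)

Σtab-zero : ∀ {m} (f : Fin m → ℕ) → (∀ i → f i ≡ 0) → sum (tabulate f) ≡ 0
Σtab-zero {zero} f e  = refl
Σtab-zero {suc m} f e = cong₂ _+_ (e Fin.zero) (Σtab-zero (λ i → f (Fin.suc i)) (λ i → e (Fin.suc i)))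

Σtab-+ : ∀ {m} (f g : Fin m → ℕ) → sum (tabulate (λ i → f i + g i)) ≡ sum (tabulate f) + sum (tabulate g)
Σtab-+ {zero} f g  = refl
Σtab-+ {suc m} f g =
  trans (cong (f Fin.zero + g Fin.zero +_) (Σtab-+ (λ i → f (Fin.suc i)) (λ i → g (Fin.suc i))))
        (interchange (f Fin.zero) (g Fin.zero) _ _)
  where
  interchange : ∀ a b c d → (a + b) + (c + d) ≡ (a + c) + (b + d)
  interchange = solve-∀

Σtab-* : ∀ {m} c (f : Fin m → ℕ) → sum (tabulate (λ i → c * f i)) ≡ c * sum (tabulate f)
Σtab-* {zero} c f  = sym (*-zeroʳ c)
Σtab-* {suc m} c f =
  trans (cong (c * f Fin.zero +_) (Σtab-* c (λ i → f (Fin.suc i)))) (sym (*-distribˡ-+ c (f Fin.zero) _))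

multiset : ∀ {m} → (Fin m → ℕ) → (Fin m → ℕ) → List ℕ
multiset x c = concat (tabulate (λ i → replicate (c i) (x i)))

sum-map-replicate : (f : ℕ → ℕ) (c x : ℕ) → sum (map f (replicate c x)) ≡ c * f x
sum-map-replicate f zero x    = refl
sum-map-replicate f (suc c) x = cong (f x +_) (sum-map-replicate f c x)

sum-map-concat : (f : ℕ → ℕ) (xss : List (List ℕ)) → sum (map f (concat xss)) ≡ sum (map (λ xs → sum (map f xs)) xss)
sum-map-concat f []         = refl
sum-map-concat f (xs ∷ xss) = trans (sum-map-++ f xs (concat xss)) (cong (sum (map f xs) +_) (sum-map-concat f xss))

sum-map-multiset : ∀ {m} (f : ℕ → ℕ) (x c : Fin m → ℕ)
  → sum (map f (multiset x c)) ≡ sum (tabulate (λ i → c i * f (x i)))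
sum-map-multiset {m} f x c = begin
  sum (map f (concat (tabulate (λ i → replicate (c i) (x i)))))
    ≡⟨ sum-map-concat f (tabulate (λ i → replicate (c i) (x i))) ⟩
  sum (map (λ xs → sum (map f xs)) (tabulate (λ i → replicate (c i) (x i))))
    ≡⟨ cong sum (map-tabulate (λ i → replicate (c i) (x i)) (λ xs → sum (map f xs))) ⟩
  sum (tabulate (λ i → sum (map f (replicate (c i) (x i)))))
    ≡⟨ Σtab-cong {m} _ _ (λ i → sum-map-replicate f (c i) (x i)) ⟩
  sum (tabulate (λ i → c i * f (x i))) ∎

χ-as-ind : ∀ k x c → c * χ (x ≟ k) ≡ ind k x c
χ-as-ind k x c = compare (k ≟ x) (x ≟ k)
  where
  compare : (d : Dec (k ≡ x)) (d' : Dec (x ≡ k)) → c * χ d' ≡ (if ⌊ d ⌋ then c else 0)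
  compare (yes _) (yes _)      = *-identityʳ c
  compare (no _) (no _)        = *-zeroʳ c
  compare (yes k≡x) (no x≢k)   = ⊥-elim (x≢k (sym k≡x))
  compare (no k≢x) (yes x≡k)   = ⊥-elim (k≢x (sym x≡k))

kids : Tree → List Tree
kids (node cs) = cs

mutual
  sumT : (ℕ → ℕ) → ℕ → Tree → ℕ
  sumT g μ (node cs) = g μ + sumF g μ cs

  sumF : (ℕ → ℕ) → ℕ → List Tree → ℕ
  sumF g μ []       = 0
  sumF g μ (c ∷ cs) = sumT g (μ + size c) c + sumF g μ cs

mutual
  AllT : (ℕ → Set) → ℕ → Tree → Set
  AllT P μ (node cs) = P μ × AllF P μ cs

  AllF : (ℕ → Set) → ℕ → List Tree → Set
  AllF P μ []       = ⊤
  AllF P μ (c ∷ cs) = AllT P (μ + size c) c × AllF P μ cs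

mutual
  sumT-vertices : ∀ (g : ℕ → ℕ) μ t → sum (map (λ v → g (labelFrom μ t v)) (allVertices t)) ≡ sumT g μ t
  sumT-vertices g μ (node cs) =
    cong (g μ +_) (trans (cong sum (sym (map-∘ (allF cs)))) (sumF-vertices g μ cs))

  sumF-vertices : ∀ (g : ℕ → ℕ) μ cs → sum (map (λ p → g (labelF μ cs p)) (allF cs)) ≡ sumF g μ cs
  sumF-vertices g μ []       = refl
  sumF-vertices g μ (c ∷ cs) = begin
    sum (map G (map VertexF.here (allVertices c) ++ map VertexF.there (allF cs)))
      ≡⟨ sum-map-++ G (map VertexF.here (allVertices c)) (map VertexF.there (allF cs)) ⟩
    sum (map G (map VertexF.here (allVertices c))) + sum (map G (map VertexF.there (allF cs)))
      ≡⟨ cong₂ _+_ (trans (cong sum (sym (map-∘ (allVertices c)))) (sumT-vertices g (μ + size c) c))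
                   (trans (cong sum (sym (map-∘ (allF cs)))) (sumF-vertices g μ cs)) ⟩
    sumT g (μ + size c) c + sumF g μ cs ∎
    where
    G : VertexF (c ∷ cs) → ℕ
    G p = g (labelF μ (c ∷ cs) p)

labels : Tree → List ℕ
labels t = map (label t) (allVertices t)

sum-map-labels : ∀ (g : ℕ → ℕ) t → sum (map g (labels t)) ≡ sumT g 0 t
sum-map-labels g t = trans (cong sum (sym (map-∘ (allVertices t)))) (sumT-vertices g 0 t)

avCoeff-as-count : ∀ t k → avCoeff t k ≡ count k (labels t)
avCoeff-as-count t k =
  trans (length-filter-χ (λ v → label t v ≟ k) (allVertices t)) (cong sum (map-∘ (allVertices t)))

mutual
  allT-vertex : ∀ {P : ℕ → Set} μ t → AllT P μ t → (v : Vertex t) → P (labelFrom μ t v)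
  allT-vertex μ (node cs) (p , ps) root    = p
  allT-vertex μ (node cs) (p , ps) (sub q) = allF-vertex μ cs ps q

  allF-vertex : ∀ {P : ℕ → Set} μ cs → AllF P μ cs → (q : VertexF cs) → P (labelF μ cs q)
  allF-vertex μ (c ∷ cs) (p , ps) (here v)  = allT-vertex (μ + size c) c p v
  allF-vertex μ (c ∷ cs) (p , ps) (there q) = allF-vertex μ cs ps q

mutual
  allT-zip : ∀ {P Q R : ℕ → Set} → (∀ {k} → P k → Q k → R k) → ∀ μ t → AllT P μ t → AllT Q μ t → AllT R μ t
  allT-zip f μ (node cs) (p , ps) (q , qs) = f p q , allF-zip f μ cs ps qs

  allF-zip : ∀ {P Q R : ℕ → Set} → (∀ {k} → P k → Q k → R k) → ∀ μ cs → AllF P μ cs → AllF Q μ cs → AllF R μ cs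
  allF-zip f μ [] _ _ = tt
  allF-zip f μ (c ∷ cs) (p , ps) (q , qs) = allT-zip f (μ + size c) c p q , allF-zip f μ cs ps qs

mutual
  allT-map : ∀ {P Q : ℕ → Set} → (∀ {k} → P k → Q k) → ∀ μ t → AllT P μ t → AllT Q μ t
  allT-map f μ (node cs) (p , ps) = f p , allF-map f μ cs ps

  allF-map : ∀ {P Q : ℕ → Set} → (∀ {k} → P k → Q k) → ∀ μ cs → AllF P μ cs → AllF Q μ cs
  allF-map f μ [] _ = tt
  allF-map f μ (c ∷ cs) (p , ps) = allT-map f (μ + size c) c p , allF-map f μ cs ps

allF-trees : ∀ {P : ℕ → Set} μ cs → AllF P μ cs → All (λ u → AllT P (μ + size u) u) cs
allF-trees μ [] _ = []
allF-trees μ (c ∷ cs) (p , ps) = p ∷ allF-trees μ cs ps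

mutual
  labels-≥ : ∀ {m} μ t → m ≤ μ → AllT (m ≤_) μ t
  labels-≥ μ (node cs) m≤μ = m≤μ , labelsF-≥ μ cs m≤μ

  labelsF-≥ : ∀ {m} μ cs → m ≤ μ → AllF (m ≤_) μ cs
  labelsF-≥ μ [] _ = tt
  labelsF-≥ μ (c ∷ cs) m≤μ = labels-≥ (μ + size c) c (≤-trans m≤μ (m≤m+n μ (size c))) , labelsF-≥ μ cs m≤μ

size-pos : ∀ t → 0 < size t
size-pos (node _) = s≤s z≤n

labels-below : ∀ μ cs → AllF (μ <_) μ cs
labels-below μ []       = tt
labels-below μ (c ∷ cs) = labels-≥ (μ + size c) c (m<m+n μ (size-pos c)) , labels-below μ cs

mutual
  sumT-zero : ∀ g μ t → sumT g μ t ≡ 0 → AllT (λ k → g k ≡ 0) μ t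
  sumT-zero g μ (node cs) e = m+n≡0⇒m≡0 (g μ) e , sumF-zero g μ cs (m+n≡0⇒n≡0 (g μ) e)

  sumF-zero : ∀ g μ cs → sumF g μ cs ≡ 0 → AllF (λ k → g k ≡ 0) μ cs
  sumF-zero g μ [] e = tt
  sumF-zero g μ (c ∷ cs) e =
    sumT-zero g (μ + size c) c (m+n≡0⇒m≡0 _ e) , sumF-zero g μ cs (m+n≡0⇒n≡0 (sumT g (μ + size c) c) e)

mutual
  sumT-vanish : ∀ g μ t → AllT (λ k → g k ≡ 0) μ t → sumT g μ t ≡ 0
  sumT-vanish g μ (node cs) (p , ps) = cong₂ _+_ p (sumF-vanish g μ cs ps)

  sumF-vanish : ∀ g μ cs → AllF (λ k → g k ≡ 0) μ cs → sumF g μ cs ≡ 0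
  sumF-vanish g μ [] _ = refl
  sumF-vanish g μ (c ∷ cs) (p , ps) = cong₂ _+_ (sumT-vanish g (μ + size c) c p) (sumF-vanish g μ cs ps)

mutual
  sumT-ones : ∀ g μ t → AllT (λ k → g k ≡ 1) μ t → sumT g μ t ≡ size t
  sumT-ones g μ (node cs) (p , ps) = cong₂ _+_ p (sumF-ones g μ cs ps)

  sumF-ones : ∀ g μ cs → AllF (λ k → g k ≡ 1) μ cs → sumF g μ cs ≡ sizes cs
  sumF-ones g μ [] _ = refl
  sumF-ones g μ (c ∷ cs) (p , ps) = cong₂ _+_ (sumT-ones g (μ + size c) c p) (sumF-ones g μ cs ps)

mutual
  vertex≤sumT : ∀ g μ t (v : Vertex t) → g (labelFrom μ t v) ≤ sumT g μ t
  vertex≤sumT g μ (node cs) root    = m≤m+n (g μ) _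
  vertex≤sumT g μ (node cs) (sub q) = ≤-trans (vertex≤sumF g μ cs q) (m≤n+m _ (g μ))

  vertex≤sumF : ∀ g μ cs (q : VertexF cs) → g (labelF μ cs q) ≤ sumF g μ cs
  vertex≤sumF g μ (c ∷ cs) (here v)  = ≤-trans (vertex≤sumT g (μ + size c) c v) (m≤m+n _ _)
  vertex≤sumF g μ (c ∷ cs) (there q) = ≤-trans (vertex≤sumF g μ cs q) (m≤n+m _ _)

sumF-as-list : ∀ g μ cs → sumF g μ cs ≡ sum (map (λ u → sumT g (μ + size u) u) cs)
sumF-as-list g μ []       = refl
sumF-as-list g μ (c ∷ cs) = cong (sumT g (μ + size c) c +_) (sumF-as-list g μ cs)

sizes-as-list : ∀ cs → sizes cs ≡ sum (map size cs)
sizes-as-list []       = refl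
sizes-as-list (c ∷ cs) = cong (size c +_) (sizes-as-list cs)

sizes-by-level : ∀ cs → sizes cs ≡ length cs + sum (map (λ c → sizes (kids c)) cs)
sizes-by-level []              = refl
sizes-by-level (node ds ∷ cs)  = cong suc (begin
  sizes ds + sizes cs
    ≡⟨ cong (sizes ds +_) (sizes-by-level cs) ⟩
  sizes ds + (length cs + rest)
    ≡⟨ sym (+-assoc (sizes ds) (length cs) rest) ⟩
  sizes ds + length cs + rest
    ≡⟨ cong (_+ rest) (+-comm (sizes ds) (length cs)) ⟩
  length cs + sizes ds + rest
    ≡⟨ +-assoc (length cs) (sizes ds) rest ⟩
  length cs + (sizes ds + rest) ∎)
  where
  rest : ℕ
  rest = sum (map (λ c → sizes (kids c)) cs)

forest-vertex : ∀ {P : ℕ → Set} μ cs → All (λ u → AllF P (μ + size u) (kids u)) cs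
  → (q : VertexF cs) → parentF q ≡ nothing ⊎ P (labelF μ cs q)
forest-vertex μ (u ∷ us) (_ ∷ below) (there q) with forest-vertex μ us below q
... | inj₁ isRoot = inj₁ (cong (Maybe.map VertexF.there) isRoot)
... | inj₂ p      = inj₂ p
forest-vertex μ (u ∷ us) _ (here root) = inj₁ refl
forest-vertex μ (node ds ∷ us) (below ∷ _) (here (sub r)) = inj₂ (allF-vertex (μ + size (node ds)) ds below r)

-- The setting of the theorem, with the hypotheses its proof actually uses.
module Setting (n C : ℕ) (a : Fin (3 * n) → ℕ) (a-pos : ∀ i → 1 ≤ a i)
               (Σa : sum (tabulate a) ≡ n * C) (lam : ℕ) (lam≥3 : 3 ≤ lam)
               (ts : List Tree) (hav : ∀ k → 1 ≤ k → avCoeff (node ts) k ≡ Pcoeff n C a lam k) where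

  T : Tree
  T = node ts

  Λ : ℕ
  Λ = lam * C + 1

  A B cc : Fin (3 * n) → ℕ
  A i  = lam * C + 1 + lam * a i
  B i  = lam * C + lam * a i + 2
  cc i = lam * a i ∸ 1

  λa≥ : ∀ {m} i → m ≤ lam → m ≤ lam * a i
  λa≥ i m≤lam = ≤-trans (≤-reflexive (sym (*-identityʳ _))) (*-mono-≤ m≤lam (a-pos i))

  B-as : ∀ i → B i ≡ Λ + (lam * a i + 1)
  B-as i = regroup (lam * C) (lam * a i)
    where
    regroup : ∀ x y → x + y + 2 ≡ x + 1 + (y + 1)
    regroup = solve-∀

  0<Λ : 0 < Λ
  0<Λ = m≤n+m 1 (lam * C)

  Λ<A : ∀ i → Λ < A i
  Λ<A i = m<m+n Λ (λa≥ i (≤-trans (s≤s z≤n) lam≥3))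

  Λ<B : ∀ i → Λ < B i
  Λ<B i = subst (Λ <_) (sym (B-as i)) (m<m+n Λ (m≤n+m 1 _))

  no-collision : ∀ r x y → 0 < r → r < lam → lam * x + r ≢ lam * y
  no-collision (suc r) x y _ r<lam e =
    >⇒∤ r<lam (∣m+n∣m⇒∣n (subst (lam ∣_) (sym e) (m∣m*n y)) (m∣m*n x))

  B+1-as : ∀ i → B i + 1 ≡ Λ + (lam * a i + 2)
  B+1-as i = regroup (lam * C) (lam * a i)
    where
    regroup : ∀ x y → x + y + 2 + 1 ≡ x + 1 + (y + 2)
    regroup = solve-∀

  IsA IsB AB Supp : ℕ → Set
  IsA k  = ∃ λ i → k ≡ A i
  IsB k  = ∃ λ i → k ≡ B i
  AB k   = IsA k ⊎ IsB k
  Supp k = k ≡ Λ ⊎ AB k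

  isA? : ∀ k → Dec (IsA k)
  isA? k = any? (λ i → k ≟ A i)

  Supp? : ∀ k → Dec (Supp k)
  Supp? k = (k ≟ Λ) ⊎-dec (isA? k ⊎-dec any? (λ i → k ≟ B i))

  B≢A : ∀ i j → B i ≢ A j
  B≢A i j e = no-collision 1 (a i) (a j) (s≤s z≤n) (≤-trans (s≤s (s≤s z≤n)) lam≥3)
    (+-cancelˡ-≡ Λ _ _ (trans (sym (B-as i)) e))

  B+1≢A : ∀ i j → B i + 1 ≢ A j
  B+1≢A i j e = no-collision 2 (a i) (a j) (s≤s z≤n) lam≥3
    (+-cancelˡ-≡ Λ _ _ (trans (sym (B+1-as i)) e))

  B+1≢B : ∀ i j → B i + 1 ≢ B j
  B+1≢B i j e = no-collision 1 (a i) (a j) (s≤s z≤n) (≤-trans (s≤s (s≤s z≤n)) lam≥3)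
    (suc-injective (trans (sym (+-suc (lam * a i) 1)) (trans shifted (+-comm (lam * a j) 1))))
    where
    shifted : lam * a i + 2 ≡ lam * a j + 1
    shifted = +-cancelˡ-≡ Λ _ _ (trans (sym (B+1-as i)) (trans e (B-as j)))

  ¬A-Λ : ¬ IsA Λ
  ¬A-Λ (i , e) = <-irrefl e (Λ<A i)

  ¬A-B : ∀ i → ¬ IsA (B i)
  ¬A-B i (j , e) = B≢A i j e

  ¬A-0 : ¬ IsA 0
  ¬A-0 (i , e) = <-irrefl e (<-trans 0<Λ (Λ<A i))

  AB-consecutive : ∀ {k} → AB k → AB (k + 1) → IsA k
  AB-consecutive (inj₁ isA) _ = isA
  AB-consecutive (inj₂ (i , refl)) (inj₁ (j , e)) = ⊥-elim (B+1≢A i j e)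
  AB-consecutive (inj₂ (i , refl)) (inj₂ (j , e)) = ⊥-elim (B+1≢B i j e)

  AB-offset≥2 : ∀ s → AB (Λ + s) → 2 ≤ s
  AB-offset≥2 s (inj₁ (i , e)) =
    subst (2 ≤_) (sym (+-cancelˡ-≡ Λ _ _ e)) (λa≥ i (≤-trans (s≤s (s≤s z≤n)) lam≥3))
  AB-offset≥2 s (inj₂ (i , e)) =
    subst (2 ≤_) (sym (+-cancelˡ-≡ Λ _ _ (trans e (B-as i)))) (+-monoˡ-≤ 1 (λa≥ i (≤-trans (s≤s z≤n) lam≥3)))

  Supp⇒Λ≤ : ∀ {k} → Supp k → Λ ≤ k
  Supp⇒Λ≤ (inj₁ refl)              = ≤-refl
  Supp⇒Λ≤ (inj₂ (inj₁ (i , refl))) = <⇒≤ (Λ<A i)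
  Supp⇒Λ≤ (inj₂ (inj₂ (i , refl))) = <⇒≤ (Λ<B i)

  Supp-above-Λ : ∀ {k} → Supp k → Λ < k → AB k
  Supp-above-Λ (inj₁ refl) Λ<Λ = ⊥-elim (<-irrefl refl Λ<Λ)
  Supp-above-Λ (inj₂ ab) _     = ab

  -- Case distinction on A-membership (kept apart from isA? so that it does not unfold h).
  A-or-not : ∀ k → IsA k ⊎ ¬ IsA k
  A-or-not k with isA? k
  ... | yes isA = inj₁ isA
  ... | no ¬isA = inj₂ ¬isA

  h : ℕ → ℕ
  h k = χ (isA? k) * (k ∸ Λ)

  h-on-A : ∀ {k} → IsA k → h k ≡ k ∸ Λ
  h-on-A {k} isA = trans (cong (_* (k ∸ Λ)) (χ-yes (isA? k) isA)) (*-identityˡ (k ∸ Λ))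

  h-off-A : ∀ {k} → ¬ IsA k → h k ≡ 0
  h-off-A {k} ¬isA = cong (_* (k ∸ Λ)) (χ-no (isA? k) ¬isA)

  h-A : ∀ i → h (A i) ≡ lam * a i
  h-A i = trans (h-on-A (i , refl)) (m+n∸m≡n Λ (lam * a i))

  target : List ℕ
  target = (replicate n Λ ++ multiset A (λ _ → 1)) ++ multiset B cc

  sum-map-target : ∀ (f : ℕ → ℕ) → sum (map f target)
    ≡ n * f Λ + sum (tabulate (λ i → 1 * f (A i))) + sum (tabulate (λ i → cc i * f (B i)))
  sum-map-target f = begin
    sum (map f target)
      ≡⟨ sum-map-++ f (replicate n Λ ++ multiset A (λ _ → 1)) (multiset B cc) ⟩
    sum (map f (replicate n Λ ++ multiset A (λ _ → 1))) + sum (map f (multiset B cc))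
      ≡⟨ cong (_+ sum (map f (multiset B cc))) (sum-map-++ f (replicate n Λ) (multiset A (λ _ → 1))) ⟩
    sum (map f (replicate n Λ)) + sum (map f (multiset A (λ _ → 1))) + sum (map f (multiset B cc))
      ≡⟨ cong₂ _+_ (cong₂ _+_ (sum-map-replicate f n Λ) (sum-map-multiset f A (λ _ → 1))) (sum-map-multiset f B cc) ⟩
    n * f Λ + sum (tabulate (λ i → 1 * f (A i))) + sum (tabulate (λ i → cc i * f (B i))) ∎

  count-target : ∀ k → count k target ≡ Pcoeff n C a lam k
  count-target k = trans (sum-map-target (λ x → χ (x ≟ k)))
    (cong₂ _+_ (cong₂ _+_ (χ-as-ind k Λ n) (Σtab-cong _ _ (λ i → χ-as-ind k (A i) 1)))
               (Σtab-cong _ _ (λ i → χ-as-ind k (B i) (cc i))))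

  moment : ∀ (g : ℕ → ℕ) → g 0 ≡ 0
    → sumT g 0 T ≡ n * g Λ + sum (tabulate (λ i → g (A i))) + sum (tabulate (λ i → cc i * g (B i)))
  moment g g0 = begin
    sumT g 0 T
      ≡⟨ sym (sum-map-labels g T) ⟩
    sum (map g (labels T))
      ≡⟨ same-counts⇒same-sums g g0 (labels T) target same-counts ⟩
    sum (map g target)
      ≡⟨ sum-map-target g ⟩
    n * g Λ + sum (tabulate (λ i → 1 * g (A i))) + sum (tabulate (λ i → cc i * g (B i)))
      ≡⟨ cong (λ s → n * g Λ + s + sum (tabulate (λ i → cc i * g (B i)))) (Σtab-cong _ _ (λ i → *-identityˡ (g (A i)))) ⟩
    n * g Λ + sum (tabulate (λ i → g (A i))) + sum (tabulate (λ i → cc i * g (B i))) ∎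
    where
    same-counts : ∀ k → 1 ≤ k → count k (labels T) ≡ count k target
    same-counts k 1≤k = trans (sym (avCoeff-as-count T k)) (trans (hav k 1≤k) (sym (count-target k)))

  Σλa : sum (tabulate (λ i → lam * a i)) ≡ lam * (n * C)
  Σλa = trans (Σtab-* lam a) (cong (lam *_) Σa)

  support : AllF Supp 0 ts
  support = allF-zip in-support 0 ts (proj₂ (sumT-zero bad 0 T no-bad-labels)) (labels-below 0 ts)
    where
    bad : ℕ → ℕ
    bad k = χ (¬? ((k ≟ 0) ⊎-dec Supp? k))
    bad-vanishes : ∀ {k} → k ≡ 0 ⊎ Supp k → bad k ≡ 0
    bad-vanishes {k} p = χ-no (¬? ((k ≟ 0) ⊎-dec Supp? k)) (λ ¬p → ¬p p)
    no-bad-labels : sumT bad 0 T ≡ 0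
    no-bad-labels = begin
      sumT bad 0 T
        ≡⟨ moment bad (bad-vanishes (inj₁ refl)) ⟩
      n * bad Λ + sum (tabulate (λ i → bad (A i))) + sum (tabulate (λ i → cc i * bad (B i)))
        ≡⟨ cong₂ _+_ (cong₂ _+_ (trans (cong (n *_) (bad-vanishes (inj₂ (inj₁ refl)))) (*-zeroʳ n))
                                (Σtab-zero _ (λ i → bad-vanishes (inj₂ (inj₂ (inj₁ (i , refl)))))))
                     (Σtab-zero _ (λ i → trans (cong (cc i *_) (bad-vanishes (inj₂ (inj₂ (inj₂ (i , refl)))))) (*-zeroʳ (cc i)))) ⟩
      0 ∎
    in-support : ∀ {k} → bad k ≡ 0 → 0 < k → Supp k
    in-support {k} bad≡0 0<k with decidable-stable ((k ≟ 0) ⊎-dec Supp? k) (χ-zero (¬? ((k ≟ 0) ⊎-dec Supp? k)) bad≡0)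
    ... | inj₁ refl = ⊥-elim (<-irrefl refl 0<k)
    ... | inj₂ s    = s

  count-Λ : sumT (λ k → χ (k ≟ Λ)) 0 T ≡ n
  count-Λ = begin
    sumT eqΛ 0 T
      ≡⟨ moment eqΛ (χ-no (0 ≟ Λ) (λ 0≡Λ → <-irrefl 0≡Λ 0<Λ)) ⟩
    n * eqΛ Λ + sum (tabulate (λ i → eqΛ (A i))) + sum (tabulate (λ i → cc i * eqΛ (B i)))
      ≡⟨ cong₂ _+_ (cong₂ _+_ (trans (cong (n *_) (χ-yes (Λ ≟ Λ) refl)) (*-identityʳ n))
                              (Σtab-zero _ (λ i → χ-no (A i ≟ Λ) (λ e → <-irrefl (sym e) (Λ<A i)))))
                   (Σtab-zero _ (λ i → trans (cong (cc i *_) (χ-no (B i ≟ Λ) (λ e → <-irrefl (sym e) (Λ<B i)))) (*-zeroʳ (cc i)))) ⟩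
    n + 0 + 0
      ≡⟨ trans (+-identityʳ (n + 0)) (+-identityʳ n) ⟩
    n ∎
    where
    eqΛ : ℕ → ℕ
    eqΛ k = χ (k ≟ Λ)

  vertex-count : sizes ts ≡ n + lam * (n * C)
  vertex-count = begin
    sizes ts
      ≡⟨ sym (sumF-ones nz 0 ts (allF-map (λ 0<k → χ-yes (¬? (_ ≟ 0)) (>⇒≢ 0<k)) 0 ts (labels-below 0 ts))) ⟩
    sumT nz 0 T
      ≡⟨ moment nz (χ-no (¬? (0 ≟ 0)) (λ 0≢0 → 0≢0 refl)) ⟩
    n * nz Λ + sum (tabulate (λ i → nz (A i))) + sum (tabulate (λ i → cc i * nz (B i)))
      ≡⟨ cong₂ _+_ (cong₂ _+_ (trans (cong (n *_) (nz-pos 0<Λ)) (*-identityʳ n))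
                              (Σtab-cong _ _ (λ i → nz-pos (<-trans 0<Λ (Λ<A i)))))
                   (Σtab-cong _ _ (λ i → trans (cong (cc i *_) (nz-pos (<-trans 0<Λ (Λ<B i)))) (*-identityʳ (cc i)))) ⟩
    n + sum (tabulate one) + sum (tabulate cc)
      ≡⟨ +-assoc n _ _ ⟩
    n + (sum (tabulate one) + sum (tabulate cc))
      ≡⟨ cong (n +_) (sym (Σtab-+ one cc)) ⟩
    n + sum (tabulate (λ i → 1 + cc i))
      ≡⟨ cong (n +_) (trans (Σtab-cong _ _ (λ i → m+[n∸m]≡n (λa≥ i (≤-trans (s≤s z≤n) lam≥3)))) Σλa) ⟩
    n + lam * (n * C) ∎
    where
    nz : ℕ → ℕ
    nz k = χ (¬? (k ≟ 0))
    nz-pos : ∀ {k} → 0 < k → nz k ≡ 1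
    nz-pos {k} 0<k = χ-yes (¬? (k ≟ 0)) (>⇒≢ 0<k)
    one : Fin (3 * n) → ℕ
    one _ = 1

  height-total : sumT h 0 T ≡ lam * (n * C)
  height-total = begin
    sumT h 0 T
      ≡⟨ moment h (h-off-A ¬A-0) ⟩
    n * h Λ + sum (tabulate (λ i → h (A i))) + sum (tabulate (λ i → cc i * h (B i)))
      ≡⟨ cong₂ _+_ (cong₂ _+_ (trans (cong (n *_) (h-off-A ¬A-Λ)) (*-zeroʳ n)) (Σtab-cong _ _ h-A))
                   (Σtab-zero _ (λ i → trans (cong (cc i *_) (h-off-A (¬A-B i))) (*-zeroʳ (cc i)))) ⟩
    sum (tabulate (λ i → lam * a i)) + 0
      ≡⟨ trans (+-identityʳ _) Σλa ⟩
    lam * (n * C) ∎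

  root-label : ∀ {P : ℕ → Set} μ t → AllT P μ t → P μ
  root-label μ (node _) (p , _) = p

  -- A child c of the root is labelled |c|, so |c| ≥ Λ, and only these vertices can carry Λ.
  children-sizes≥Λ : All (λ c → Λ ≤ size c) ts
  children-sizes≥Λ = All.map (λ {c} p → Supp⇒Λ≤ (root-label (size c) c p)) (allF-trees 0 ts support)

  children-of-size-Λ : count Λ (map size ts) ≡ n
  children-of-size-Λ = begin
    count Λ (map size ts)
      ≡⟨ cong sum (sym (map-∘ ts)) ⟩
    sum (map (λ c → χ (size c ≟ Λ)) ts)
      ≡⟨ sum-map-cong _ _ ts (All.map (λ {c} → only-root c) children-sizes≥Λ) ⟩
    sum (map (λ c → sumT eqΛ (size c) c) ts)
      ≡⟨ sym (sumF-as-list eqΛ 0 ts) ⟩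
    sumF eqΛ 0 ts
      ≡⟨ cong (_+ sumF eqΛ 0 ts) (sym (χ-no (0 ≟ Λ) (λ 0≡Λ → <-irrefl 0≡Λ 0<Λ))) ⟩
    sumT eqΛ 0 T
      ≡⟨ count-Λ ⟩
    n ∎
    where
    eqΛ : ℕ → ℕ
    eqΛ k = χ (k ≟ Λ)
    only-root : ∀ c → Λ ≤ size c → χ (size c ≟ Λ) ≡ sumT eqΛ (size c) c
    only-root (node cs) Λ≤ = sym (trans (cong (eqΛ (size (node cs)) +_)
      (sumF-vanish eqΛ _ cs (allF-map (λ lt → χ-no (_ ≟ Λ) (>⇒≢ (≤-<-trans Λ≤ lt))) _ cs (labels-below _ cs))))
      (+-identityʳ _))

  -- The children of the root have total size nΛ, at least Λ each, and n of them have size Λ: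
  -- so all of them have size exactly Λ.
  children-size-Λ : All (λ c → size c ≡ Λ) ts
  children-size-Λ = map⁻ (all-equal-by-sum Λ (map size ts) (map⁺ children-sizes≥Λ) total)
    where
    total : sum (map size ts) ≡ Λ * count Λ (map size ts)
    total = begin
      sum (map size ts)       ≡⟨ sym (sizes-as-list ts) ⟩
      sizes ts                ≡⟨ vertex-count ⟩
      n + lam * (n * C)       ≡⟨ regroup n lam C ⟩
      Λ * n                   ≡⟨ cong (Λ *_) (sym children-of-size-Λ) ⟩
      Λ * count Λ (map size ts) ∎
      where
      regroup : ∀ m l c → m + l * (m * c) ≡ (l * c + 1) * m
      regroup = solve-∀

  grandchildren-size : sum (map (λ c → sizes (kids c)) ts) ≡ lam * (n * C)
  grandchildren-size = +-cancelˡ-≡ n _ _ (begin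
    n + sum (map (λ c → sizes (kids c)) ts)
      ≡⟨ cong (_+ sum (map (λ c → sizes (kids c)) ts)) (sym n-children) ⟩
    length ts + sum (map (λ c → sizes (kids c)) ts)
      ≡⟨ sym (sizes-by-level ts) ⟩
    sizes ts
      ≡⟨ vertex-count ⟩
    n + lam * (n * C) ∎)
    where
    n-children : length ts ≡ n
    n-children = trans (sym (length-map size ts))
      (trans (sym (count-all-equal Λ (map size ts) (map⁺ children-size-Λ))) children-of-size-Λ)

  grandchildren-AB : All (λ c → AllF AB Λ (kids c)) ts
  grandchildren-AB = All.zipWith below-child (allF-trees 0 ts support , children-size-Λ)
    where
    below-child : ∀ {c} → AllT Supp (size c) c × size c ≡ Λ → AllF AB Λ (kids c)
    below-child {node cs} ((_ , supp) , size≡Λ) =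
      allF-zip Supp-above-Λ Λ cs (subst (λ μ → AllF Supp μ cs) size≡Λ supp) (labels-below Λ cs)

  grandchildren-height : sum (map (λ c → sumF h Λ (kids c)) ts) ≡ lam * (n * C)
  grandchildren-height = begin
    sum (map (λ c → sumF h Λ (kids c)) ts)
      ≡⟨ sym (sum-map-cong _ _ ts (All.map (λ {c} → child-height c) children-size-Λ)) ⟩
    sum (map (λ c → sumT h (size c) c) ts)
      ≡⟨ sym (sumF-as-list h 0 ts) ⟩
    sumF h 0 ts
      ≡⟨ cong (_+ sumF h 0 ts) (sym (h-off-A ¬A-0)) ⟩
    sumT h 0 T
      ≡⟨ height-total ⟩
    lam * (n * C) ∎
    where
    child-height : ∀ c → size c ≡ Λ → sumT h (size c) c ≡ sumF h Λ (kids c)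
    child-height (node cs) size≡Λ =
      subst (λ μ → h μ + sumF h μ cs ≡ sumF h Λ cs) (sym size≡Λ) (cong (_+ sumF h Λ cs) (h-off-A ¬A-Λ))

  -- A tree with at least two vertices and all labels in A ∪ B has an A-labelled vertex:
  -- follow first children down to a vertex whose first child is a leaf.
  has-A-vertex : ∀ μ t → AllT AB μ t → 2 ≤ size t → Σ (Vertex t) (λ v → IsA (labelFrom μ t v))
  has-A-vertex μ (node []) _ (s≤s ())
  has-A-vertex μ (node (node [] ∷ cs)) (ab , (ab-leaf , _) , _) _ = root , AB-consecutive ab ab-leaf
  has-A-vertex μ (node (d@(node (node _ ∷ _)) ∷ cs)) (_ , ab-d , _) _
    with has-A-vertex (μ + size d) d ab-d (s≤s (s≤s z≤n))
  ... | v , isA = sub (here v) , isA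

  -- Below a vertex labelled Λ, a child u is labelled Λ + |u|.  If all labels of its subtree lie
  -- in A ∪ B, the subtree's height is either |u| plus the height strictly below u (u is
  -- A-labelled), or exceeds |u| (u is B-labelled, and a deeper A-vertex is higher than |u|).
  height-dichotomy : ∀ u → AllT AB (Λ + size u) u
    → sumT h (Λ + size u) u ≡ size u + sumF h (Λ + size u) (kids u) ⊎ size u < sumT h (Λ + size u) u
  height-dichotomy u@(node cs) ab@(ab-root , _) with A-or-not (Λ + size u)
  ... | inj₁ isA = inj₁ (cong (_+ sumF h (Λ + size u) cs) (trans (h-on-A isA) (m+n∸m≡n Λ (size u))))
  ... | inj₂ ¬isA with has-A-vertex (Λ + size u) u ab (AB-offset≥2 (size u) ab-root)
  ...   | root , isA  = ⊥-elim (¬isA isA)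
  ...   | sub w , isA =
    inj₂ (<-≤-trans higher (≤-trans (vertex≤sumF h (Λ + size u) cs w) (m≤n+m _ (h (Λ + size u)))))
    where
    ℓ : ℕ
    ℓ = labelF (Λ + size u) cs w
    higher : size u < h ℓ
    higher = subst (size u <_) (sym (h-on-A isA))
      (m+n≤o⇒m≤o∸n (suc (size u)) (subst (_≤ ℓ) (cong suc (+-comm Λ (size u)))
        (allF-vertex (Λ + size u) cs (labels-below (Λ + size u) cs) w)))

  -- No vertex strictly below u is A-labelled.
  Shallow : Tree → Set
  Shallow u = AllF (λ k → h k ≡ 0) (Λ + size u) (kids u)

  subtree-lower : ∀ u → AllT AB (Λ + size u) u → size u ≤ sumT h (Λ + size u) u
  subtree-lower u ab with height-dichotomy u ab
  ... | inj₁ e  = ≤-trans (m≤m+n (size u) _) (≤-reflexive (sym e))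
  ... | inj₂ lt = <⇒≤ lt

  subtree-tight : ∀ u → AllT AB (Λ + size u) u → size u ≡ sumT h (Λ + size u) u → Shallow u
  subtree-tight u ab tight with height-dichotomy u ab
  ... | inj₁ e  = sumF-zero h (Λ + size u) (kids u)
                    (+-cancelˡ-≡ (size u) _ _ (trans (sym e) (trans (sym tight) (sym (+-identityʳ (size u))))))
  ... | inj₂ lt = ⊥-elim (<-irrefl tight lt)

  forest-lower : ∀ cs → AllF AB Λ cs → sizes cs ≤ sumF h Λ cs
  forest-lower cs ab = subst₂ _≤_ (sym (sizes-as-list cs)) (sym (sumF-as-list h Λ cs))
    (sum-map-mono size _ cs (All.map (λ {u} → subtree-lower u) (allF-trees Λ cs ab)))

  forest-tight : ∀ cs → AllF AB Λ cs → sizes cs ≡ sumF h Λ cs → All Shallow cs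
  forest-tight cs ab tight = All.zipWith (λ {u} (ab-u , e) → subtree-tight u ab-u e) (abs , equalities)
    where
    abs : All (λ u → AllT AB (Λ + size u) u) cs
    abs = allF-trees Λ cs ab
    equalities : All (λ u → size u ≡ sumT h (Λ + size u) u) cs
    equalities = sum-map-tight size _ cs (All.map (λ {u} → subtree-lower u) abs)
      (trans (sym (sizes-as-list cs)) (trans tight (sumF-as-list h Λ cs)))

  -- Sizes and heights of the grandchildren's subtrees have the same total, so every
  -- inequality above is tight: no vertex at depth ≥ 3 is A-labelled.
  depth≥3-not-A : All (λ c → All Shallow (kids c)) ts
  depth≥3-not-A = All.zipWith (λ {c} (ab , e) → forest-tight (kids c) ab e) (grandchildren-AB , equalities)
    where
    equalities : All (λ c → sizes (kids c) ≡ sumF h Λ (kids c)) ts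
    equalities = sum-map-tight (λ c → sizes (kids c)) (λ c → sumF h Λ (kids c)) ts
      (All.map (λ {c} → forest-lower (kids c)) grandchildren-AB)
      (trans grandchildren-size (sym grandchildren-height))

  h-A-pos : ∀ i → h (A i) ≢ 0
  h-A-pos i h≡0 = <-irrefl (sym (trans (sym (h-A i)) h≡0)) (λa≥ i (≤-trans (s≤s z≤n) lam≥3))

  A-vertex-parentF : ∀ cs → All (λ c → size c ≡ Λ) cs → All (λ c → All Shallow (kids c)) cs
    → (p : VertexF cs) → IsA (labelF 0 cs p)
    → Σ (VertexF cs) (λ w → parentF p ≡ just w × labelF 0 cs w ≡ Λ)
  A-vertex-parentF (c ∷ cs) (_ ∷ sizes≡Λ) (_ ∷ shallow) (there p) isA
    with A-vertex-parentF cs sizes≡Λ shallow p isA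
  ... | w , parent≡w , label≡Λ = there w , cong (Maybe.map VertexF.there) parent≡w , label≡Λ
  A-vertex-parentF (c ∷ cs) (size≡Λ ∷ _) _ (here root) (i , e) = ⊥-elim (¬A-Λ (i , trans (sym size≡Λ) e))
  A-vertex-parentF (node ds ∷ cs) (size≡Λ ∷ _) (shallow ∷ _) (here (sub q)) (i , e)
    with forest-vertex (size (node ds)) ds
           (subst (λ μ → All (λ u → AllF (λ k → h k ≡ 0) (μ + size u) (kids u)) ds) (sym size≡Λ) shallow) q
  ... | inj₁ q-is-root = here root , cong (λ m → just (here (maybe sub root m))) q-is-root , size≡Λ
  ... | inj₂ h≡0       = ⊥-elim (h-A-pos i (trans (cong h (sym e)) h≡0))

  A-vertex-parent : (v : Vertex T) → IsA (label T v) → Σ (Vertex T) (λ w → parent v ≡ just w × label T w ≡ Λ)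
  A-vertex-parent root isA = ⊥-elim (¬A-0 isA)
  A-vertex-parent (sub p) isA = lift (A-vertex-parentF ts children-size-Λ depth≥3-not-A p isA)
    where
    lift : Σ (VertexF ts) (λ w → parentF p ≡ just w × labelF 0 ts w ≡ Λ)
         → Σ (Vertex T) (λ w → parent (sub p) ≡ just w × label T w ≡ Λ)
    lift (w , parent≡w , label≡Λ) = sub w , cong (λ m → just (maybe sub root m)) parent≡w , label≡Λ

lemma5 : (n C : ℕ) → 1 ≤ n → (a : Fin (3 * n) → ℕ)
    → (∀ i → C < 4 * a i) → (∀ i → 2 * a i < C)
    → sum (tabulate a) ≡ n * C
    → (lam : ℕ) → 3 * n < lam
    → (T : Tree) → (∀ k → 1 ≤ k → avCoeff T k ≡ Pcoeff n C a lam k)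
    → (v : Vertex T) → (∃ λ i → label T v ≡ lam * C + 1 + lam * a i)
    → Σ (Vertex T) (λ w → parent v ≡ just w × label T w ≡ lam * C + 1)
lemma5 n C n≥1 a C<4a _ Σa lam 3n<lam (node ts) hav =
  Setting.A-vertex-parent n C a a-pos Σa lam lam≥3 ts hav
  where
  a-pos : ∀ i → 1 ≤ a i
  a-pos i = *-cancelˡ-< 4 0 (a i) (≤-<-trans z≤n (C<4a i))
  lam≥3 : 3 ≤ lam
  lam≥3 = ≤-trans (*-monoʳ-≤ 3 n≥1) (<⇒≤ 3n<lam)
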